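{- Let $k\geq1$ and $N\geq1$ be integers. Define $\psi(4k+1)=N$ and, for $4k+1<n\leq4k+9$ successively, let $\psi(n)$ be the smallest integer $y>\psi(n-1)$ with $t(y)=t(n)$. Then $\psi(4k+9)\leq N+16$.
   Context: $t(m)\in\{0,1\}$ is the parity of the number of ones in the binary expansion of $m$. -}

module Defs where

open import Data.Nat using (ℕ; zero; suc; _+_; _*_; _<_; _≤_)
open import Data.Nat.DivMod using (_/_; _%_)
open import Data.Bool using (Bool; true; false; _xor_)
open import Relation.Binary.PropositionalEquality using (_≡_)

-- Binary digit sum parity, computed by recursion on m with fuel f ≥ m.
-- tAux f m = parity of the number of ones in the binary expansion of m (when m ≤ f).
tAux : ℕ → ℕ → Bool
tAux zero    _ = false
tAux (suc f) m = (m % 2 Data.Nat.≡ᵇ 1) xor tAux f (m / 2)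

t : ℕ → Bool
t m = tAux m m

IsPsi : ℕ → ℕ → (ℕ → ℕ) → Set
IsPsi k N ψ =
  (ψ (4 * k + 1) ≡ N) ×
  (∀ n → 4 * k + 1 < n → n ≤ 4 * k + 9 →
     (ψ (Data.Nat.pred n) < ψ n) × (t (ψ n) ≡ t n) ×
     (∀ y → ψ (Data.Nat.pred n) < y → t y ≡ t n → ψ n ≤ y))
  where open import Data.Product using (_×_)

{-# OPTIONS --safe #-}
module Submission where

-- Write N = 8q + r with r < 8.  The targets t(4k+2), …, t(4k+9) are
-- ¬x, x, c, ¬c, ¬c, c, d, ¬d for x, c, d = t(k), t(k+1), t(k+2), which are
-- not all equal, and on the window [8q, 8q+32) the sequence t is determined
-- by t(q), …, t(q+3).  Hence the greedy run started at N depends only on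
-- seven bits and r, and an exhaustive check of these 2⁷·8 runs, each step
-- looking at most three places ahead, shows that it never leaves the window
-- and ends by position N + 16.

open import Data.Bool using (Bool; true; false; not; _xor_; if_then_else_)
open import Data.Bool.Properties using (xor-assoc; not-¬) renaming (_≟_ to _≟ᵇ_)
open import Data.List using (List; []; _∷_; applyUpTo)
open import Data.Nat
open import Data.Nat.DivMod
open import Data.Nat.Divisibility using (divides-refl)
open import Data.Nat.Properties
open import Data.Nat.Tactic.RingSolver using (solve-∀)
open import Data.Product using (_×_; _,_; proj₂; ∃-syntax; uncurry; <_,_>)
open import Data.Sum using (_⊎_; inj₁; inj₂)
open import Data.Unit using (⊤; tt)
open import Function using (_∘_)
open import Relation.Binary.PropositionalEquality
open import Relation.Nullary using (Dec; yes; does; ¬?)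
open import Relation.Nullary.Decidable using (map′; from-yes; _×-dec_; _⊎-dec_; _→-dec_)

open import Defs

tAux-zero : ∀ f → tAux f 0 ≡ false
tAux-zero zero    = refl
tAux-zero (suc f) = tAux-zero f

half-≤ : ∀ {m f} → m ≤ suc f → m / 2 ≤ f
half-≤ {zero}  _   = z≤n
half-≤ {suc m} m≤ = ≤-pred (≤-trans (m/n<m (suc m) 2 (s≤s (s≤s z≤n))) m≤)

tAux-fuel : ∀ {f g m} → m ≤ f → m ≤ g → tAux f m ≡ tAux g m
tAux-fuel {zero}  {g}     z≤n _   = sym (tAux-zero g)
tAux-fuel {suc f} {zero}  _   z≤n = tAux-zero (suc f)
tAux-fuel {suc f} {suc g} {m} m≤f m≤g =
  cong ((m % 2 ≡ᵇ 1) xor_) (tAux-fuel (half-≤ m≤f) (half-≤ m≤g))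

t-unfold : ∀ m → t m ≡ (m % 2 ≡ᵇ 1) xor t (m / 2)
t-unfold zero    = refl
t-unfold (suc p) = cong ((suc p % 2 ≡ᵇ 1) xor_) (tAux-fuel (half-≤ {f = p} ≤-refl) ≤-refl)

t-2*+ : ∀ q j → t (2 * q + j) ≡ (j % 2 ≡ᵇ 1) xor t (j / 2 + q)
t-2*+ q j = begin
  t (2 * q + j)                                  ≡⟨ cong t 2q+j≡j+q*2 ⟩
  t (j + q * 2)                                  ≡⟨ t-unfold (j + q * 2) ⟩
  ((j + q * 2) % 2 ≡ᵇ 1) xor t ((j + q * 2) / 2) ≡⟨ cong₂ (λ b m → (b ≡ᵇ 1) xor t m) ([m+kn]%n≡m%n j q 2) [j+q*2]/2≡j/2+q ⟩
  (j % 2 ≡ᵇ 1) xor t (j / 2 + q)                 ∎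
  where
  open ≡-Reasoning
  2q+j≡j+q*2 : 2 * q + j ≡ j + q * 2
  2q+j≡j+q*2 = trans (+-comm (2 * q) j) (cong (j +_) (*-comm 2 q))
  [j+q*2]/2≡j/2+q : (j + q * 2) / 2 ≡ j / 2 + q
  [j+q*2]/2≡j/2+q = trans (+-distrib-/-∣ʳ j (divides-refl q)) (cong (j / 2 +_) (m*n/n≡m q 2))

window : ℕ → (ℕ → Bool) → ℕ → Bool
window e v j = tAux e j xor v (j / 2 ^ e)
  where instance _ = m^n≢0 2 e

t-window : ∀ e q j → t (2 ^ e * q + j) ≡ window e (λ a → t (a + q)) j
t-window zero q j =
  cong t (trans (cong (_+ j) (+-identityʳ q)) (trans (+-comm q j) (cong (_+ q) (sym (n/1≡n j)))))
t-window (suc e) q j = begin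
  t (2 * 2 ^ e * q + j)                        ≡⟨ cong (λ m → t (m + j)) (*-assoc 2 (2 ^ e) q) ⟩
  t (2 * (2 ^ e * q) + j)                      ≡⟨ t-2*+ (2 ^ e * q) j ⟩
  b xor t (j / 2 + 2 ^ e * q)                  ≡⟨ cong (λ m → b xor t m) (+-comm (j / 2) (2 ^ e * q)) ⟩
  b xor t (2 ^ e * q + j / 2)                  ≡⟨ cong (b xor_) (t-window e q (j / 2)) ⟩
  b xor (tAux e (j / 2) xor t (j / 2 / 2 ^ e + q)) ≡⟨ xor-assoc b (tAux e (j / 2)) _ ⟨
  tAux (suc e) j xor t (j / 2 / 2 ^ e + q)     ≡⟨ cong (λ m → tAux (suc e) j xor t (m + q)) (m/n/o≡m/[n*o] j 2 (2 ^ e)) ⟩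
  window (suc e) (λ a → t (a + q)) j           ∎
  where
  open ≡-Reasoning
  b = j % 2 ≡ᵇ 1
  instance
    _ = m^n≢0 2 e
    _ = m^n≢0 2 (suc e)

window-cong : ∀ e m {v w : ℕ → Bool} → (∀ {a} → a < m → v a ≡ w a) →
              ∀ {j} → j < m * 2 ^ e → window e v j ≡ window e w j
window-cong e m v≗w {j} j< = cong (tAux e j xor_) (v≗w (m<n*o⇒m/o<n j<))
  where instance _ = m^n≢0 2 e

t-pair-differs : ∀ m → t (2 * m) ≢ t (1 + 2 * m)
t-pair-differs m eq = not-¬ refl (trans eq t-odd)
  where
  open ≡-Reasoning
  t-odd : t (1 + 2 * m) ≡ not (t (2 * m))
  t-odd = begin
    t (1 + 2 * m)       ≡⟨ cong t (+-comm 1 (2 * m)) ⟩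
    t (2 * m + 1)       ≡⟨ t-window 1 m 1 ⟩
    not (t m)           ≡⟨ cong not (t-window 1 m 0) ⟨
    not (t (2 * m + 0)) ≡⟨ cong (not ∘ t) (+-identityʳ (2 * m)) ⟩
    not (t (2 * m))     ∎

even-or-odd : ∀ k → ∃[ m ] (k ≡ 2 * m ⊎ k ≡ 1 + 2 * m)
even-or-odd zero = 0 , inj₁ refl
even-or-odd (suc k) with even-or-odd k
... | m , inj₁ refl = m , inj₂ refl
... | m , inj₂ refl = suc m , inj₁ (cong suc (sym (+-suc m (m + 0))))

t-no-three-equal : ∀ k → t k ≢ t (1 + k) ⊎ t (1 + k) ≢ t (2 + k)
t-no-three-equal k with even-or-odd k
... | m , inj₁ refl = inj₁ (t-pair-differs m)
... | m , inj₂ refl = inj₂ (subst (λ n → t n ≢ t (1 + n)) 2[1+m]≡2+2m (t-pair-differs (suc m)))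
  where
  2[1+m]≡2+2m : 2 * suc m ≡ 2 + 2 * m
  2[1+m]≡2+2m = cong suc (+-suc m (m + 0))

_!_ : List Bool → ℕ → Bool
[]       ! _     = false
(b ∷ bs) ! zero  = b
(b ∷ bs) ! suc i = bs ! i

applyUpTo-! : ∀ (v : ℕ → Bool) {n i} → i < n → applyUpTo v n ! i ≡ v i
applyUpTo-! v {suc n} {zero}  _         = refl
applyUpTo-! v {suc n} {suc i} (s≤s i<n) = applyUpTo-! (v ∘ suc) i<n

-- Only the minimality half of the greedy recursion, which is all an upper bound uses.
IsGreedy : (u τ : ℕ → Bool) → ℕ → (ℕ → ℕ) → Set
IsGreedy u τ L φ = ∀ {i} → i < L → ∀ {y} → φ i < y → u y ≡ τ (suc i) → φ (suc i) ≤ y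

IsGreedy-cong : ∀ {u τ τ′ L φ} → (∀ {i} → i < L → τ (suc i) ≡ τ′ (suc i)) →
                IsGreedy u τ L φ → IsGreedy u τ′ L φ
IsGreedy-cong τ≗τ′ greedy i<L φi<y uy≡ = greedy i<L φi<y (trans uy≡ (sym (τ≗τ′ i<L)))

8+[4k+1]≡4k+9 : ∀ k → 8 + (4 * k + 1) ≡ 4 * k + 9
8+[4k+1]≡4k+9 = solve-∀

IsPsi⇒IsGreedy : ∀ {k N ψ} → IsPsi k N ψ →
                 IsGreedy t (λ i → t (i + (4 * k + 1))) 8 (λ i → ψ (i + (4 * k + 1)))
IsPsi⇒IsGreedy {k} (_ , ψ-step) {i} i<8 {y} = proj₂ (proj₂ (ψ-step _ after before)) y
  where
  after : 4 * k + 1 < suc i + (4 * k + 1)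
  after = m<n+m (4 * k + 1) {suc i} (s≤s z≤n)
  before : suc i + (4 * k + 1) ≤ 4 * k + 9
  before = ≤-trans (+-monoˡ-≤ (4 * k + 1) i<8) (≤-reflexive (8+[4k+1]≡4k+9 k))

nextMatch : (ℕ → Bool) → Bool → ℕ → ℕ
nextMatch s b J =
  if does (s (1 + J) ≟ᵇ b) then 1 + J else
  if does (s (2 + J) ≟ᵇ b) then 2 + J else 3 + J

nextMatch-> : ∀ s b J → J < nextMatch s b J
nextMatch-> s b J with does (s (1 + J) ≟ᵇ b) | does (s (2 + J) ≟ᵇ b)
... | true  | _     = n<1+n J
... | false | true  = m<n+m J {2} (s≤s z≤n)
... | false | false = m<n+m J {3} (s≤s z≤n)

-- Opaque because each step mentions its starting position several times:
-- unfolding a run whose start is a variable produces terms of size 3ⁿ.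
opaque
  run : (s τ : ℕ → Bool) → ℕ → ℕ → ℕ
  run s τ r zero    = r
  run s τ r (suc n) = nextMatch s (τ (suc n)) (run s τ r n)

Hits : ℕ → (s τ : ℕ → Bool) → ℕ → ℕ → Set
Hits W s τ r zero    = ⊤
Hits W s τ r (suc n) = Hits W s τ r n × s (run s τ r (suc n)) ≡ τ (suc n) × run s τ r (suc n) < W

hits? : ∀ W s τ r n → Dec (Hits W s τ r n)
hits? W s τ r zero    = yes tt
hits? W s τ r (suc n) =
  hits? W s τ r n ×-dec (s (run s τ r (suc n)) ≟ᵇ τ (suc n)) ×-dec (run s τ r (suc n) <? W)

opaque
  unfolding run
  greedy-≤-run : ∀ {u τ L φ W s B r} → IsGreedy u τ L φ → (∀ {j} → j < W → s j ≡ u (B + j)) →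
                 φ 0 ≤ B + r → ∀ {n} → n ≤ L → Hits W s τ r n → φ n ≤ B + run s τ r n
  greedy-≤-run greedy agree start {zero}  _   _ = start
  greedy-≤-run {τ = τ} {φ = φ} {s = s} {B} {r} greedy agree start {suc n} n<L (hits , hit , inWindow) =
    greedy n<L φn<next (trans (sym (agree inWindow)) hit)
    where
    φn<next : φ n < B + run s τ r (suc n)
    φn<next = ≤-<-trans (greedy-≤-run greedy agree start (<⇒≤ n<L) hits)
                        (+-monoʳ-< B (nextMatch-> s (τ (suc n)) (run s τ r n)))

∀-Bool? : {P : Bool → Set} → (∀ b → Dec (P b)) → Dec (∀ b → P b)
∀-Bool? P? = map′ (λ (Ptrue , Pfalse) → λ { true → Ptrue ; false → Pfalse })
                  (λ ∀P → ∀P true , ∀P false)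
                  (P? true ×-dec P? false)

oracle : List Bool → ℕ → Bool
oracle ws = window 3 (ws !_)

-- Step i of the run from ψ(4k+1) aims at t(4k+1+i), i.e. at offset 1+i from 4k.
targets : List Bool → ℕ → Bool
targets xs i = window 2 (xs !_) (suc i)

record ShortRun (xs ws : List Bool) (r : ℕ) : Set where
  constructor shortRun
  field
    hits      : Hits 32 (oracle ws) (targets xs) r 8
    ends-≤+16 : run (oracle ws) (targets xs) r 8 ≤ r + 16

shortRun? : ∀ xs ws r → Dec (ShortRun xs ws r)
shortRun? xs ws r = map′ (uncurry shortRun) < ShortRun.hits , ShortRun.ends-≤+16 >
  (hits? 32 (oracle ws) (targets xs) r 8 ×-dec (run (oracle ws) (targets xs) r 8 ≤? r + 16))

AllShortRuns : Set
AllShortRuns = ∀ x c d → x ≢ c ⊎ c ≢ d → ∀ w₀ w₁ w₂ w₃ {r} → r < 8 →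
               ShortRun (x ∷ c ∷ d ∷ []) (w₀ ∷ w₁ ∷ w₂ ∷ w₃ ∷ []) r

opaque
  unfolding run
  allShortRuns : AllShortRuns
  allShortRuns = from-yes
    (∀-Bool? λ x → ∀-Bool? λ c → ∀-Bool? λ d →
     (¬? (x ≟ᵇ c) ⊎-dec ¬? (c ≟ᵇ d)) →-dec
     ∀-Bool? λ w₀ → ∀-Bool? λ w₁ → ∀-Bool? λ w₂ → ∀-Bool? λ w₃ →
     allUpTo? (shortRun? (x ∷ c ∷ d ∷ []) (w₀ ∷ w₁ ∷ w₂ ∷ w₃ ∷ [])) 8)

targets-agree : ∀ k {i} → i < 8 →
                t (suc i + (4 * k + 1)) ≡ targets (t k ∷ t (1 + k) ∷ t (2 + k) ∷ []) (suc i)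
targets-agree k {i} i<8 = begin
  t (suc i + (4 * k + 1))                   ≡⟨ cong t (reindex k i) ⟩
  t (4 * k + (2 + i))                       ≡⟨ t-window 2 k (2 + i) ⟩
  window 2 (λ a → t (a + k)) (2 + i)        ≡⟨ window-cong 2 3 (λ a<3 → sym (applyUpTo-! (λ a → t (a + k)) a<3)) 2+i<12 ⟩
  targets (t k ∷ t (1 + k) ∷ t (2 + k) ∷ []) (suc i) ∎
  where
  open ≡-Reasoning
  reindex : ∀ k i → suc i + (4 * k + 1) ≡ 4 * k + (2 + i)
  reindex = solve-∀
  2+i<12 : 2 + i < 12
  2+i<12 = s≤s (s≤s (≤-trans i<8 (m≤n+m 8 2)))

oracle-agree : ∀ q {j} → j < 32 → oracle (t q ∷ t (1 + q) ∷ t (2 + q) ∷ t (3 + q) ∷ []) j ≡ t (8 * q + j)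
oracle-agree q {j} j<32 = trans (window-cong 3 4 (applyUpTo-! (λ a → t (a + q))) j<32) (sym (t-window 3 q j))

theorem5 : (k N : ℕ) → k ≥ 1 → N ≥ 1 → (ψ : ℕ → ℕ) → IsPsi k N ψ →
    ψ (4 * k + 9) ≤ N + 16
theorem5 k N _ _ ψ h@(ψ[4k+1]≡N , _) = begin
  ψ (4 * k + 9)                            ≡⟨ cong ψ (8+[4k+1]≡4k+9 k) ⟨
  ψ (8 + (4 * k + 1))                      ≤⟨ greedy-≤-run greedy agree ψ[4k+1]≤8q+r ≤-refl (ShortRun.hits short) ⟩
  8 * q + run (oracle ws) (targets xs) r 8 ≤⟨ +-monoʳ-≤ (8 * q) (ShortRun.ends-≤+16 short) ⟩
  8 * q + (r + 16)                         ≡⟨ +-assoc (8 * q) r 16 ⟨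
  8 * q + r + 16                           ≡⟨ cong (_+ 16) N≡8q+r ⟨
  N + 16                                   ∎
  where
  open ≤-Reasoning
  q r : ℕ
  q = N / 8
  r = N % 8
  N≡8q+r : N ≡ 8 * q + r
  N≡8q+r = trans (m≡m%n+[m/n]*n N 8) (trans (+-comm r (q * 8)) (cong (_+ r) (*-comm q 8)))
  xs ws : List Bool
  xs = t k ∷ t (1 + k) ∷ t (2 + k) ∷ []
  ws = t q ∷ t (1 + q) ∷ t (2 + q) ∷ t (3 + q) ∷ []
  short : ShortRun xs ws r
  short = allShortRuns (t k) (t (1 + k)) (t (2 + k)) (t-no-three-equal k)
                       (t q) (t (1 + q)) (t (2 + q)) (t (3 + q)) (m%n<n N 8)
  agree : ∀ {j} → j < 32 → oracle ws j ≡ t (8 * q + j)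
  agree = oracle-agree q
  ψ[4k+1]≤8q+r : ψ (4 * k + 1) ≤ 8 * q + r
  ψ[4k+1]≤8q+r = ≤-reflexive (trans ψ[4k+1]≡N N≡8q+r)
  greedy : IsGreedy t (targets xs) 8 (λ i → ψ (i + (4 * k + 1)))
  greedy = IsGreedy-cong {τ = λ i → t (i + (4 * k + 1))} {τ′ = targets xs} (targets-agree k) (IsPsi⇒IsGreedy {k} h)
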